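{- Let $n\ge 2$ be an integer and let $n_1>n_2\ge 1$, $k_1,k_2\ge 1$ be integers with $k_1n_1+k_2n_2=n$, so that $(n_1^{k_1},n_2^{k_2})$ is a partition of $n$ into two different parts. Then $(n_1^{k_1},n_2^{k_2})$ belongs to the orbit of partitions generated by $r/n$ for some integer $r$ with $1\le r<n$ and $\gcd(r,n)=1$ if and only if $\gcd(n_1,n_2)=1$ and $\gcd(k_1,k_2)=1$.
   Context: Notation: $(n_1^{k_1},n_2^{k_2})$ denotes the partition of $k_1n_1+k_2n_2$ having $k_1$ parts equal to $n_1$ and $k_2$ parts equal to $n_2$. Let $\Phi_0=\begin{pmatrix}0&1\\1&1\end{pmatrix}$ and $\Phi_1=\begin{pmatrix}1&0\\1&1\end{pmatrix}$, acting on column vectors. The Farey map is $F:[0,1]\to[0,1]$, $F(x)=(1-x)/x$ for $x\in[1/2,1]$ and $F(x)=x/(1-x)$ for $x\in[0,1/2]$. For a rational $x\in(0,1)$ let $\ell\ge 0$ be least with $F^{\ell}(x)=1/2$; the binary sequence of $x$ is $\sigma(x)=\sigma_1\cdots\sigma_\ell$ where $\sigma_j=0$ if $F^{j-1}(x)\in(1/2,1)$ and $\sigma_j=1$ if $F^{j-1}(x)\in(0,1/2)$. If $x=p/q$ in lowest terms then $(p,q)^T=\Phi_{\sigma_1}\cdots\Phi_{\sigma_\ell}(1,2)^T$. Orbit of partitions: for $n\ge2$, $1\le r<n$, $\gcd(r,n)=1$ and $\sigma(r/n)=\sigma_1\cdots\sigma_\ell$, for each $m=1,\dots,\ell$ write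 $\Phi_{\sigma_1}\cdots\Phi_{\sigma_m}=\begin{pmatrix}h_2(m)&h_1(m)\\k_2(m)&k_1(m)\end{pmatrix}$ and $(n_2(m),n_1(m))^T=\Phi_{\sigma_{m+1}}\cdots\Phi_{\sigma_\ell}(1,2)^T$. Then $n=k_1(m)n_1(m)+k_2(m)n_2(m)$ with $n_1(m)>n_2(m)\ge 1$, giving the partition $(n_1(m)^{k_1(m)},n_2(m)^{k_2(m)})$ of $n$ of generation $m$. The orbit of partitions generated by $r/n$ is the sequence of these partitions for $m=1,\dots,\ell$. -}

module Defs where

open import Data.Nat using (ℕ; zero; suc; _+_; _*_; _∸_; _<_; _≤_)
open import Data.Nat.GCD using (gcd)
open import Data.List using (List; []; _∷_; _++_; foldr)
open import Data.Product using (Σ; _×_; _,_; ∃-syntax)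
open import Relation.Binary.PropositionalEquality using (_≡_; _≢_)

data Bit : Set where
  b0 b1 : Bit

record Mat : Set where
  constructor mat
  field a b c d : ℕ
open Mat public

_·_ : Mat → Mat → Mat
mat a₁ b₁ c₁ d₁ · mat a₂ b₂ c₂ d₂ =
  mat (a₁ * a₂ + b₁ * c₂) (a₁ * b₂ + b₁ * d₂)
      (c₁ * a₂ + d₁ * c₂) (c₁ * b₂ + d₁ * d₂)

I₂ : Mat
I₂ = mat 1 0 0 1

Φ : Bit → Mat
Φ b0 = mat 0 1 1 1
Φ b1 = mat 1 0 1 1

Φs : List Bit → Mat
Φs = foldr (λ x M → Φ x · M) I₂

_⊙_ : Mat → ℕ × ℕ → ℕ × ℕ
mat a b c d ⊙ (x , y) = (a * x + b * y , c * x + d * y)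

-- BinSeq p q s : s is the binary sequence σ(p/q) of the rational p/q ∈ (0,1)
-- (q ≠ 0), obtained by iterating the Farey map until reaching 1/2.
--   F(p/q) = (q-p)/p  when p/q ∈ (1/2,1)   (digit 0)
--   F(p/q) = p/(q-p)  when p/q ∈ (0,1/2)   (digit 1)
data BinSeq : ℕ → ℕ → List Bit → Set where
  half : ∀ {p q} → 2 * p ≡ q → BinSeq p q []
  step0 : ∀ {p q s} → q < 2 * p → p < q →
          BinSeq (q ∸ p) p s → BinSeq p q (b0 ∷ s)
  step1 : ∀ {p q s} → 0 < p → 2 * p < q →
          BinSeq p (q ∸ p) s → BinSeq p q (b1 ∷ s)

-- The partition (n₁^{k₁}, n₂^{k₂}) is the partition of generation m of the
-- orbit determined by the binary sequence s = σ₁⋯σ_ℓ, for some 1 ≤ m ≤ ℓ: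
-- s = pre ++ suf with pre = σ₁⋯σ_m nonempty,
-- Φs pre = (h₂ h₁ ; k₂ k₁),  (n₂ , n₁)ᵀ = Φs suf (1 , 2)ᵀ.
InOrbitSeq : List Bit → (n₁ k₁ n₂ k₂ : ℕ) → Set
InOrbitSeq s n₁ k₁ n₂ k₂ =
  ∃[ pre ] ∃[ suf ] (s ≡ pre ++ suf × pre ≢ [] ×
    c (Φs pre) ≡ k₂ × d (Φs pre) ≡ k₁ ×
    (Φs suf ⊙ (1 , 2)) ≡ (n₂ , n₁))

InOrbit : (r n : ℕ) → (n₁ k₁ n₂ k₂ : ℕ) → Set
InOrbit r n n₁ k₁ n₂ k₂ =
  ∃[ s ] (BinSeq r n s × InOrbitSeq s n₁ k₁ n₂ k₂)

-- Multiplying a vector by Φ₀ or Φ₁ (on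
-- either side) is a Euclid step such as (u, v) ↦ (v, u + v) or (u, u + v), which preserves
-- coprimality; this gives necessity.  Conversely, Euclid's algorithm run backwards reaches
-- every coprime pair, producing pre from (k₂, k₁) and suf from (n₂, n₁); and for every
-- s the vector (Φs s)(1, 2)ᵀ = (r, n)ᵀ is a reduced fraction r/n ∈ (0, 1) with σ(r/n) = s.
module Submission where

open import Defs
open import Data.Nat using (ℕ; _+_; _*_; _<_; _≤_; z≤n; s≤s)
open import Data.Nat.Properties
open import Data.Nat.Induction using (<-wellFounded)
open import Data.Nat.GCD using (gcd)
open import Data.Nat.Divisibility using (∣m∣n⇒∣m+n; ∣-refl)
open import Data.Nat.Coprimality as Coprime
  using (Coprime; coprime-+; 1-coprimeTo; coprime⇒gcd≡1; gcd≡1⇒coprime)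
open import Data.Nat.Tactic.RingSolver using (solve-∀)
open import Data.List using (List; []; _∷_; _++_; [_])
open import Data.List.Properties using (++-conicalʳ)
open import Data.Product using (_×_; ∃-syntax; _,_; proj₁; proj₂; map; uncurry)
open import Function.Base using (_on_)
open import Function.Bundles using (_⇔_; mk⇔)
open import Induction.WellFounded using (WfRec; module All)
import Relation.Binary.Construct.On as On
open import Relation.Binary.Definitions using (tri<; tri≈; tri>)
open import Relation.Binary.PropositionalEquality hiding ([_])
open ≡-Reasoning

coprime-+ˡ : ∀ {m n} → Coprime m n → Coprime (m + n) n
coprime-+ˡ {m} {n} c = subst (λ k → Coprime k n) (+-comm n m) (coprime-+ c)

coprime-+ʳ : ∀ {m n} → Coprime m n → Coprime m (m + n)
coprime-+ʳ c = Coprime.sym (coprime-+ (Coprime.sym c))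

coprime-+ʳ⁻¹ : ∀ {m n} → Coprime m (m + n) → Coprime m n
coprime-+ʳ⁻¹ c (d∣m , d∣n) = c (d∣m , ∣m∣n⇒∣m+n d∣m d∣n)

coprime-self⇒≡1 : ∀ {n} → Coprime n n → n ≡ 1
coprime-self⇒≡1 c = c (∣-refl , ∣-refl)

m<m+n⇒0<n : ∀ m {n} → m < m + n → 0 < n
m<m+n⇒0<n m {n} lt = +-cancelˡ-< m 0 n (subst (_< m + n) (sym (+-identityʳ m)) lt)

1*x+0*y≡x : ∀ x y → 1 * x + 0 * y ≡ x
1*x+0*y≡x = solve-∀

0*x+1*y≡y : ∀ x y → 0 * x + 1 * y ≡ y
0*x+1*y≡y = solve-∀

1*x+1*y≡x+y : ∀ x y → 1 * x + 1 * y ≡ x + y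
1*x+1*y≡x+y = solve-∀

x*1+y*0≡x : ∀ x y → x * 1 + y * 0 ≡ x
x*1+y*0≡x = solve-∀

x*0+y*1≡y : ∀ x y → x * 0 + y * 1 ≡ y
x*0+y*1≡y = solve-∀

x*1+y*1≡x+y : ∀ x y → x * 1 + y * 1 ≡ x + y
x*1+y*1≡x+y = solve-∀

mat-cong : ∀ {a b c d a′ b′ c′ d′} → a ≡ a′ → b ≡ b′ → c ≡ c′ → d ≡ d′ →
           mat a b c d ≡ mat a′ b′ c′ d′
mat-cong refl refl refl refl = refl

·-assoc-entry : ∀ x y a b c d z w →
  (x * a + y * c) * z + (x * b + y * d) * w ≡ x * (a * z + b * w) + y * (c * z + d * w)
·-assoc-entry = solve-∀

·-assoc : ∀ A B C → (A · B) · C ≡ A · (B · C)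
·-assoc (mat a₁ b₁ c₁ d₁) (mat a₂ b₂ c₂ d₂) (mat a₃ b₃ c₃ d₃) = mat-cong
  (·-assoc-entry a₁ b₁ a₂ b₂ c₂ d₂ a₃ c₃) (·-assoc-entry a₁ b₁ a₂ b₂ c₂ d₂ b₃ d₃)
  (·-assoc-entry c₁ d₁ a₂ b₂ c₂ d₂ a₃ c₃) (·-assoc-entry c₁ d₁ a₂ b₂ c₂ d₂ b₃ d₃)

·-identityˡ : ∀ A → I₂ · A ≡ A
·-identityˡ (mat a b c d) =
  mat-cong (1*x+0*y≡x a c) (1*x+0*y≡x b d) (0*x+1*y≡y a c) (0*x+1*y≡y b d)

·-identityʳ : ∀ A → A · I₂ ≡ A
·-identityʳ (mat a b c d) =
  mat-cong (x*1+y*0≡x a b) (x*0+y*1≡y a b) (x*1+y*0≡x c d) (x*0+y*1≡y c d)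

Φs-++ : ∀ l m → Φs (l ++ m) ≡ Φs l · Φs m
Φs-++ []      m = sym (·-identityˡ (Φs m))
Φs-++ (x ∷ l) m = trans (cong (Φ x ·_) (Φs-++ l m)) (sym (·-assoc (Φ x) (Φs l) (Φs m)))

⊙-· : ∀ A B v → (A · B) ⊙ v ≡ A ⊙ (B ⊙ v)
⊙-· (mat a₁ b₁ c₁ d₁) (mat a₂ b₂ c₂ d₂) (x , y) =
  cong₂ _,_ (·-assoc-entry a₁ b₁ a₂ b₂ c₂ d₂ x y) (·-assoc-entry c₁ d₁ a₂ b₂ c₂ d₂ x y)

_⋆_ : ℕ × ℕ → Mat → ℕ × ℕ
(u , v) ⋆ mat a b c d = (u * a + v * c , u * b + v * d)

⋆-· : ∀ w A B → w ⋆ (A · B) ≡ (w ⋆ A) ⋆ B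
⋆-· (u , v) (mat a₁ b₁ c₁ d₁) (mat a₂ b₂ c₂ d₂) =
  cong₂ _,_ (entry u v a₁ b₁ c₁ d₁ a₂ c₂) (entry u v a₁ b₁ c₁ d₁ b₂ d₂)
  where
  entry : ∀ u v a b c d x y →
    u * (a * x + b * y) + v * (c * x + d * y) ≡ (u * a + v * c) * x + (u * b + v * d) * y
  entry = solve-∀

⋆-identityʳ : ∀ w → w ⋆ I₂ ≡ w
⋆-identityʳ (u , v) = cong₂ _,_ (x*1+y*0≡x u v) (x*0+y*1≡y u v)

bottomRow : Mat → ℕ × ℕ
bottomRow M = (c M , d M)

bottomRow-⋆ : ∀ M → (0 , 1) ⋆ M ≡ bottomRow M
bottomRow-⋆ M = cong₂ _,_ (+-identityʳ (c M)) (+-identityʳ (d M))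

columnStep : Bit → ℕ × ℕ → ℕ × ℕ
columnStep b0 (u , v) = (v , u + v)
columnStep b1 (u , v) = (u , u + v)

rowStep : Bit → ℕ × ℕ → ℕ × ℕ
rowStep b0 (u , v) = (v , u + v)
rowStep b1 (u , v) = (u + v , v)

Φ-⊙ : ∀ x w → Φ x ⊙ w ≡ columnStep x w
Φ-⊙ b0 (u , v) = cong₂ _,_ (0*x+1*y≡y u v) (1*x+1*y≡x+y u v)
Φ-⊙ b1 (u , v) = cong₂ _,_ (1*x+0*y≡x u v) (1*x+1*y≡x+y u v)

⋆-Φ : ∀ x w → w ⋆ Φ x ≡ rowStep x w
⋆-Φ b0 (u , v) = cong₂ _,_ (x*0+y*1≡y u v) (x*1+y*1≡x+y u v)
⋆-Φ b1 (u , v) = cong₂ _,_ (x*1+y*1≡x+y u v) (x*0+y*1≡y u v)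

bottomRow-snoc : ∀ l x → bottomRow (Φs (l ++ [ x ])) ≡ rowStep x (bottomRow (Φs l))
bottomRow-snoc l x = begin
  bottomRow (Φs (l ++ [ x ]))   ≡⟨ cong bottomRow (Φs-++ l [ x ]) ⟩
  bottomRow (Φs l · (Φ x · I₂)) ≡⟨ cong (λ M → bottomRow (Φs l · M)) (·-identityʳ (Φ x)) ⟩
  bottomRow (Φs l) ⋆ Φ x        ≡⟨ ⋆-Φ x (bottomRow (Φs l)) ⟩
  rowStep x (bottomRow (Φs l))  ∎

fraction : List Bit → ℕ × ℕ
fraction s = Φs s ⊙ (1 , 2)

fraction-∷ : ∀ x s → fraction (x ∷ s) ≡ columnStep x (fraction s)
fraction-∷ x s = trans (⊙-· (Φ x) (Φs s) (1 , 2)) (Φ-⊙ x (fraction s))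

fraction-++ : ∀ l m → fraction (l ++ m) ≡ Φs l ⊙ fraction m
fraction-++ l m = trans (cong (_⊙ (1 , 2)) (Φs-++ l m)) (⊙-· (Φs l) (Φs m) (1 , 2))

CoprimePair : ℕ × ℕ → Set
CoprimePair = uncurry Coprime

PositiveCoprimePair : ℕ × ℕ → Set
PositiveCoprimePair (u , v) = 1 ≤ u × 1 ≤ v × Coprime u v

ReducedProperFraction : ℕ × ℕ → Set
ReducedProperFraction (p , q) = 1 ≤ p × p < q × Coprime p q

rowStep-coprime : ∀ x {w} → CoprimePair w → CoprimePair (rowStep x w)
rowStep-coprime b0 c = Coprime.sym (coprime-+ˡ c)
rowStep-coprime b1 c = coprime-+ˡ c

⋆-Φs-coprime : ∀ l {w} → CoprimePair w → CoprimePair (w ⋆ Φs l)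
⋆-Φs-coprime []      {w} c = subst CoprimePair (sym (⋆-identityʳ w)) c
⋆-Φs-coprime (x ∷ l) {w} c = subst CoprimePair (sym (⋆-· w (Φ x) (Φs l)))
  (⋆-Φs-coprime l (subst CoprimePair (sym (⋆-Φ x w)) (rowStep-coprime x c)))

bottomRow-coprime : ∀ l → CoprimePair (bottomRow (Φs l))
bottomRow-coprime l =
  subst CoprimePair (bottomRow-⋆ (Φs l)) (⋆-Φs-coprime l (Coprime.sym (1-coprimeTo 0)))

columnStep-reduced : ∀ x {w} → ReducedProperFraction w → ReducedProperFraction (columnStep x w)
columnStep-reduced b0 (1≤p , p<q , c) =
  ≤-trans 1≤p (<⇒≤ p<q) , m<n+m _ 1≤p , Coprime.sym (coprime-+ˡ c)
columnStep-reduced b1 (1≤p , p<q , c) =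
  1≤p , m<m+n _ (≤-trans 1≤p (<⇒≤ p<q)) , coprime-+ʳ c

fraction-reduced : ∀ s → ReducedProperFraction (fraction s)
fraction-reduced []      = s≤s z≤n , s≤s (s≤s z≤n) , 1-coprimeTo 2
fraction-reduced (x ∷ s) =
  subst ReducedProperFraction (sym (fraction-∷ x s)) (columnStep-reduced x (fraction-reduced s))

BinSeqOf : List Bit → ℕ × ℕ → Set
BinSeqOf s (p , q) = BinSeq p q s

2*n≡n+n : ∀ n → 2 * n ≡ n + n
2*n≡n+n n = cong (n +_) (+-identityʳ n)

columnStep-binSeq : ∀ x {s w} → ReducedProperFraction w → BinSeqOf s w →
                    BinSeqOf (x ∷ s) (columnStep x w)
columnStep-binSeq b0 {s} {p , q} (1≤p , p<q , _) σ =
  step0 (subst (p + q <_) (sym (2*n≡n+n q)) (+-monoˡ-< q p<q)) (m<n+m q 1≤p)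
        (subst (λ r → BinSeq r q s) (sym (m+n∸n≡m p q)) σ)
columnStep-binSeq b1 {s} {p , q} (1≤p , p<q , _) σ =
  step1 1≤p (subst (_< p + q) (sym (2*n≡n+n p)) (+-monoʳ-< p p<q))
        (subst (λ r → BinSeq p r s) (sym (m+n∸m≡n p q)) σ)

fraction-binSeq : ∀ s → BinSeqOf s (fraction s)
fraction-binSeq []      = half refl
fraction-binSeq (x ∷ s) = subst (BinSeqOf (x ∷ s)) (sym (fraction-∷ x s))
  (columnStep-binSeq x (fraction-reduced s) (fraction-binSeq s))

fraction-surjective : ∀ w → ReducedProperFraction w → ∃[ s ] fraction s ≡ w
fraction-surjective = All.wfRec (On.wellFounded proj₂ <-wellFounded) _ Reached reach
  where
  Reached : ℕ × ℕ → Set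
  Reached w = ReducedProperFraction w → ∃[ s ] fraction s ≡ w

  reach : ∀ w → WfRec (_<_ on proj₂) Reached w → Reached w
  reach (p , q) rec (1≤p , p<q , c) with m≤n⇒∃[o]m+o≡n (<⇒≤ p<q)
  ... | x , refl with <-cmp p x
  ... | tri≈ _ refl _ with coprime-self⇒≡1 (coprime-+ʳ⁻¹ c)
  ...   | refl = [] , refl
  reach (p , q) rec (1≤p , p<q , c) | x , refl | tri< p<x _ _
    with rec {p , x} (m<n+m x 1≤p) (1≤p , p<x , coprime-+ʳ⁻¹ c)
  ... | s , eq = b1 ∷ s , trans (fraction-∷ b1 s) (cong (columnStep b1) eq)
  reach (p , q) rec (1≤p , p<q , c) | x , refl | tri> _ _ x<p
    with rec {x , p} (m<m+n p (m<m+n⇒0<n p p<q))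
             (m<m+n⇒0<n p p<q , x<p , Coprime.sym (coprime-+ʳ⁻¹ c))
  ... | s , eq = b0 ∷ s , (begin
    fraction (b0 ∷ s)          ≡⟨ fraction-∷ b0 s ⟩
    columnStep b0 (fraction s) ≡⟨ cong (columnStep b0) eq ⟩
    (p , x + p)                ≡⟨ cong (p ,_) (+-comm x p) ⟩
    (p , p + x)                ∎)

bottomRow-surjective : ∀ w → PositiveCoprimePair w → ∃[ l ] (l ≢ [] × bottomRow (Φs l) ≡ w)
bottomRow-surjective = All.wfRec (On.wellFounded (uncurry _+_) <-wellFounded) _ Reached reach
  where
  Reached : ℕ × ℕ → Set
  Reached w = PositiveCoprimePair w → ∃[ l ] (l ≢ [] × bottomRow (Φs l) ≡ w)

  snoc≢[] : ∀ l x → l ++ [ x ] ≢ []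
  snoc≢[] l x eq with ++-conicalʳ l [ x ] eq
  ... | ()

  reach : ∀ w → WfRec (_<_ on uncurry _+_) Reached w → Reached w
  reach (u , v) rec (1≤u , 1≤v , c) with <-cmp u v
  ... | tri≈ _ refl _ with coprime-self⇒≡1 c
  ...   | refl = [ b0 ] , (λ ()) , refl
  reach (u , v) rec (1≤u , 1≤v , c) | tri< u<v _ _ with m≤n⇒∃[o]m+o≡n (<⇒≤ u<v)
  ... | x , refl with rec {x , u} (subst (_< u + (u + x)) (+-comm u x) (m<n+m (u + x) 1≤u))
                          (m<m+n⇒0<n u u<v , 1≤u , Coprime.sym (coprime-+ʳ⁻¹ c))
  ... | l , _ , eq = l ++ [ b0 ] , snoc≢[] l b0 , (begin
    bottomRow (Φs (l ++ [ b0 ]))   ≡⟨ bottomRow-snoc l b0 ⟩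
    rowStep b0 (bottomRow (Φs l))  ≡⟨ cong (rowStep b0) eq ⟩
    (u , x + u)                    ≡⟨ cong (u ,_) (+-comm x u) ⟩
    (u , u + x)                    ∎)
  reach (u , v) rec (1≤u , 1≤v , c) | tri> _ _ v<u with m≤n⇒∃[o]m+o≡n (<⇒≤ v<u)
  ... | x , refl with rec {x , v} (subst (_< (v + x) + v) (+-comm v x) (m<m+n (v + x) 1≤v))
                          (m<m+n⇒0<n v v<u , 1≤v , Coprime.sym (coprime-+ʳ⁻¹ (Coprime.sym c)))
  ... | l , _ , eq = l ++ [ b1 ] , snoc≢[] l b1 , (begin
    bottomRow (Φs (l ++ [ b1 ]))   ≡⟨ bottomRow-snoc l b1 ⟩
    rowStep b1 (bottomRow (Φs l))  ≡⟨ cong (rowStep b1) eq ⟩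
    (x + v , v)                    ≡⟨ cong (_, v) (+-comm x v) ⟩
    (v + x , v)                    ∎)

orbit-denominator : ∀ {s n₁ k₁ n₂ k₂} → InOrbitSeq s n₁ k₁ n₂ k₂ →
                    proj₂ (fraction s) ≡ k₁ * n₁ + k₂ * n₂
orbit-denominator {n₁ = n₁} {n₂ = n₂} (pre , suf , refl , _ , refl , refl , eq) = begin
  proj₂ (fraction (pre ++ suf))               ≡⟨ cong proj₂ (fraction-++ pre suf) ⟩
  proj₂ (Φs pre ⊙ fraction suf)               ≡⟨ cong (λ w → proj₂ (Φs pre ⊙ w)) eq ⟩
  c (Φs pre) * n₂ + d (Φs pre) * n₁           ≡⟨ +-comm (c (Φs pre) * n₂) _ ⟩
  d (Φs pre) * n₁ + c (Φs pre) * n₂           ∎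

inOrbitSeq⇒coprime : ∀ {s n₁ k₁ n₂ k₂} → InOrbitSeq s n₁ k₁ n₂ k₂ →
                     Coprime n₁ n₂ × Coprime k₁ k₂
inOrbitSeq⇒coprime (pre , suf , _ , _ , refl , refl , eq) =
  Coprime.sym (proj₂ (proj₂ (subst ReducedProperFraction eq (fraction-reduced suf)))) ,
  Coprime.sym (bottomRow-coprime pre)

coprime⇒inOrbitSeq : ∀ {n₁ k₁ n₂ k₂} → 1 ≤ n₂ → n₂ < n₁ → 1 ≤ k₁ → 1 ≤ k₂ →
                     Coprime n₁ n₂ → Coprime k₁ k₂ → ∃[ s ] InOrbitSeq s n₁ k₁ n₂ k₂
coprime⇒inOrbitSeq {n₁} {k₁} {n₂} {k₂} 1≤n₂ n₂<n₁ 1≤k₁ 1≤k₂ cn ck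
  with fraction-surjective (n₂ , n₁) (1≤n₂ , n₂<n₁ , Coprime.sym cn)
     | bottomRow-surjective (k₂ , k₁) (1≤k₂ , 1≤k₁ , Coprime.sym ck)
... | suf , eq | pre , pre≢[] , row =
  pre ++ suf , pre , suf , refl , pre≢[] , cong proj₁ row , cong proj₂ row , eq

inOrbitSeq⇒inOrbit : ∀ {s n₁ k₁ n₂ k₂} → InOrbitSeq s n₁ k₁ n₂ k₂ →
  let n = k₁ * n₁ + k₂ * n₂ in ∃[ r ] (1 ≤ r × r < n × Coprime r n × InOrbit r n n₁ k₁ n₂ k₂)
inOrbitSeq⇒inOrbit {s} {n₁} {k₁} {n₂} {k₂} orbit =
  package (fraction s) (fraction-reduced s) (fraction-binSeq s) (orbit-denominator orbit)
  where
  package : ∀ {n} w → ReducedProperFraction w → BinSeqOf s w → proj₂ w ≡ n →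
            ∃[ r ] (1 ≤ r × r < n × Coprime r n × InOrbit r n n₁ k₁ n₂ k₂)
  package (r , _) (1≤r , r<n , c) σ refl = r , 1≤r , r<n , c , s , σ , orbit

theorem4p4 : (n n₁ n₂ k₁ k₂ : ℕ) → 2 ≤ n → n₂ < n₁ → 1 ≤ n₂ → 1 ≤ k₁ → 1 ≤ k₂ →
    k₁ * n₁ + k₂ * n₂ ≡ n →
    (∃[ r ] (1 ≤ r × r < n × gcd r n ≡ 1 × InOrbit r n n₁ k₁ n₂ k₂))
      ⇔ (gcd n₁ n₂ ≡ 1 × gcd k₁ k₂ ≡ 1)
-- The hypothesis 2 ≤ n is implied by the others.
theorem4p4 .(k₁ * n₁ + k₂ * n₂) n₁ n₂ k₁ k₂ _ n₂<n₁ 1≤n₂ 1≤k₁ 1≤k₂ refl =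
  mk⇔ necessary sufficient
  where
  n = k₁ * n₁ + k₂ * n₂

  necessary : ∃[ r ] (1 ≤ r × r < n × gcd r n ≡ 1 × InOrbit r n n₁ k₁ n₂ k₂) →
              gcd n₁ n₂ ≡ 1 × gcd k₁ k₂ ≡ 1
  necessary (_ , _ , _ , _ , _ , _ , orbit) =
    map coprime⇒gcd≡1 coprime⇒gcd≡1 (inOrbitSeq⇒coprime orbit)

  sufficient : gcd n₁ n₂ ≡ 1 × gcd k₁ k₂ ≡ 1 →
               ∃[ r ] (1 ≤ r × r < n × gcd r n ≡ 1 × InOrbit r n n₁ k₁ n₂ k₂)
  sufficient (gn , gk)
    with coprime⇒inOrbitSeq 1≤n₂ n₂<n₁ 1≤k₁ 1≤k₂ (gcd≡1⇒coprime gn) (gcd≡1⇒coprime gk)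
  ... | _ , orbit with inOrbitSeq⇒inOrbit orbit
  ...   | r , 1≤r , r<n , c , inOrbit = r , 1≤r , r<n , coprime⇒gcd≡1 c , inOrbit
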